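{- For any $n$-element poset $P$, the poset $C_m\oplus P$ is LE-cactus for all integers $m\ge n-3$ (with $m\ge 0$).
   Context: For an $N$-element poset $R$, a linear extension is a list $(p_1,\dots,p_N)$ of all elements with $p_a<_R p_b$ implying $a<b$; ${\mathcal{L}}(R)$ is the set of these. The Bender--Knuth move $t_i$ ($1\le i\le N-1$) acts on ${\mathcal{L}}(R)$ by swapping $p_i,p_{i+1}$ if incomparable and fixing the list otherwise; $\mathcal{BK}_R$ is the permutation group they generate. Let $q_m=t_1(t_2t_1)\cdots(t_mt_{m-1}\cdots t_1)$ and $q_{jk}=q_{k-1}q_{k-j}q_{k-1}$. An $N$-element poset $R$ is LE-cactus if $(t_iq_{jk})^2=1$ holds in $\mathcal{BK}_R$ for all $2\le i+1<j<k\le N$. $C_m$ is an $m$-element chain, and $C_m\oplus P$ the ordinal sum in which every element of $C_m$ lies below every element of $P$. -}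

module Defs where

open import Data.Nat as ℕ using (ℕ; zero; suc; _∸_)
open import Data.Fin as Fin using (Fin; splitAt; join)
open import Data.Fin.Properties as FinP using (join-splitAt)
open import Data.Sum using (_⊎_; inj₁; inj₂)
open import Data.Unit using (⊤; tt)
open import Data.Empty using (⊥)
open import Data.Bool using (Bool; true; false; if_then_else_; _∨_)
open import Data.List using (List; []; _∷_; _++_; foldr)
open import Data.Vec using (Vec; []; _∷_; lookup)
open import Data.Product using (∃; _×_; _,_)
open import Relation.Nullary using (¬_; Dec; yes; no; does)
open import Relation.Binary using (Decidable; IsPartialOrder; IsPreorder)
open import Relation.Binary.PropositionalEquality
  using (_≡_; _≢_; refl; cong; sym; trans; isEquivalence)

record FinPoset (n : ℕ) : Set₁ where
  field
    _≼_            : Fin n → Fin n → Set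
    isPartialOrder : IsPartialOrder _≡_ _≼_
    _≼?_           : Decidable _≼_

  _≺_ : Fin n → Fin n → Set
  x ≺ y = (x ≼ y) × (x ≢ y)

  comparable : Fin n → Fin n → Bool
  comparable x y = does (x ≼? y) ∨ does (y ≼? x)

open FinPoset public

Chain : (m : ℕ) → FinPoset m
Chain m = record
  { _≼_ = Fin._≤_
  ; isPartialOrder = FinP.≤-isPartialOrder
  ; _≼?_ = Fin._≤?_
  }

-- Ordinal sum P ⊕ Q : every element of P lies below every element of Q.
-- Elements of P are the first m elements of Fin (m + n).

module _ {m n : ℕ} (P : FinPoset m) (Q : FinPoset n) where
  private
    module P = FinPoset P
    module Q = FinPoset Q
    module PP = IsPartialOrder P.isPartialOrder
    module QP = IsPartialOrder Q.isPartialOrder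

  SumLe : Fin m ⊎ Fin n → Fin m ⊎ Fin n → Set
  SumLe (inj₁ a) (inj₁ b) = a P.≼ b
  SumLe (inj₁ a) (inj₂ b) = ⊤
  SumLe (inj₂ a) (inj₁ b) = ⊥
  SumLe (inj₂ a) (inj₂ b) = a Q.≼ b

  SumLe-refl : ∀ x → SumLe x x
  SumLe-refl (inj₁ a) = PP.refl
  SumLe-refl (inj₂ a) = QP.refl

  SumLe-trans : ∀ x y z → SumLe x y → SumLe y z → SumLe x z
  SumLe-trans (inj₁ a) (inj₁ b) (inj₁ c) p q = PP.trans p q
  SumLe-trans (inj₁ a) (inj₁ b) (inj₂ c) p q = tt
  SumLe-trans (inj₁ a) (inj₂ b) (inj₂ c) p q = tt
  SumLe-trans (inj₂ a) (inj₂ b) (inj₂ c) p q = QP.trans p q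
  SumLe-trans (inj₁ a) (inj₂ b) (inj₁ c) p ()
  SumLe-trans (inj₂ a) (inj₁ b) z () q
  SumLe-trans (inj₂ a) (inj₂ b) (inj₁ c) p ()

  SumLe-antisym : ∀ x y → SumLe x y → SumLe y x → x ≡ y
  SumLe-antisym (inj₁ a) (inj₁ b) p q = cong inj₁ (PP.antisym p q)
  SumLe-antisym (inj₂ a) (inj₂ b) p q = cong inj₂ (QP.antisym p q)
  SumLe-antisym (inj₁ a) (inj₂ b) p ()
  SumLe-antisym (inj₂ a) (inj₁ b) () q

  SumLe? : ∀ x y → Dec (SumLe x y)
  SumLe? (inj₁ a) (inj₁ b) = a P.≼? b
  SumLe? (inj₁ a) (inj₂ b) = yes tt
  SumLe? (inj₂ a) (inj₁ b) = no (λ ())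
  SumLe? (inj₂ a) (inj₂ b) = a Q.≼? b

  OrdLe : Fin (m ℕ.+ n) → Fin (m ℕ.+ n) → Set
  OrdLe x y = SumLe (splitAt m x) (splitAt m y)

  ordLe-isPartialOrder : IsPartialOrder _≡_ OrdLe
  ordLe-isPartialOrder = record
    { isPreorder = record
      { isEquivalence = isEquivalence
      ; reflexive = λ { {x} refl → SumLe-refl (splitAt m x) }
      ; trans = λ {x} {y} {z} → SumLe-trans (splitAt m x) (splitAt m y) (splitAt m z)
      }
    ; antisym = λ {x} {y} p q →
        trans (sym (join-splitAt m n x))
          (trans (cong (join m n) (SumLe-antisym (splitAt m x) (splitAt m y) p q))
                 (join-splitAt m n y))
    }

  _⊕_ : FinPoset (m ℕ.+ n)
  _⊕_ = record
    { _≼_ = OrdLe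
    ; isPartialOrder = ordLe-isPartialOrder
    ; _≼?_ = λ x y → SumLe? (splitAt m x) (splitAt m y)
    }

-- Linear extensions: a list (p_1,…,p_N) of all elements of R (each exactly
-- once), with p_a <_R p_b ⇒ a < b.  Positions are 0-indexed Fin N here.

IsLinearExtension : {N : ℕ} → FinPoset N → Vec (Fin N) N → Set
IsLinearExtension {N} R p =
    (∀ x → ∃ λ a → lookup p a ≡ x)
  × (∀ a b → lookup p a ≡ lookup p b → a ≡ b)
  × (∀ a b → _≺_ R (lookup p a) (lookup p b) → a Fin.< b)

-- Bender–Knuth move t_i (i is 1-indexed, 1 ≤ i ≤ N-1): swap the entries in
-- (1-indexed) positions i and i+1 if they are incomparable; otherwise fix.
-- (Out-of-range indices act as the identity; they never occur below.)

bkMove : {A : Set} {k : ℕ} → (A → A → Bool) → ℕ → Vec A k → Vec A k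
bkMove c zero v = v
bkMove c (suc zero) (x ∷ y ∷ xs) = if c x y then x ∷ y ∷ xs else y ∷ x ∷ xs
bkMove c (suc (suc i)) (x ∷ xs) = x ∷ bkMove c (suc i) xs
bkMove c (suc _) v = v

t : {N : ℕ} → FinPoset N → ℕ → Vec (Fin N) N → Vec (Fin N) N
t R i = bkMove (comparable R) i

-- A word in the generators: the list [i₁, …, iₗ] denotes t_{i₁} ⋯ t_{iₗ}
-- (composition of maps; rightmost acts first).
Word : Set
Word = List ℕ

eval : {N : ℕ} → FinPoset N → Word → Vec (Fin N) N → Vec (Fin N) N
eval R w v = foldr (t R) v w

desc : ℕ → Word
desc zero = []
desc (suc m) = suc m ∷ desc m

q : ℕ → Word
q zero = []
q (suc m) = q m ++ desc (suc m)

qjk : ℕ → ℕ → Word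
qjk j k = q (k ∸ 1) ++ q (k ∸ j) ++ q (k ∸ 1)

cactusWord : ℕ → ℕ → ℕ → Word
cactusWord i j k = (i ∷ qjk j k) ++ (i ∷ qjk j k)

IsLECactus : {N : ℕ} → FinPoset N → Set
IsLECactus {N} R =
  ∀ i j k → 2 ℕ.≤ i ℕ.+ 1 → i ℕ.+ 1 ℕ.< j → j ℕ.< k → k ℕ.≤ N →
  ∀ (p : Vec (Fin N) N) → IsLinearExtension R p →
  eval R (cactusWord i j k) p ≡ p

-- In a linear extension of C_m ⊕ P the first m entries are the chain elements,
-- which are comparable with everything, so every t_s with s ≤ m, and hence every
-- q_s with s ≤ m, fixes it; every t_i preserves this shape. The q_r are
-- involutions. If i ≤ m, t_i drops out of (t_i q_{jk})² and what remains is
-- q_{jk}² = 1. Otherwise j ≥ i + 2 ≥ m + 3, so k - j ≤ n - 3 ≤ m: q_{k-j} drops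
-- out, q_{jk} collapses to q_{k-1}² = 1, and what remains is t_i² = 1.
module Submission where

open import Defs
open import Data.Nat as ℕ using (ℕ; zero; suc; _+_; _<_; _≤_; _∸_; z≤n; s≤s)
open import Data.Nat.Properties as ℕ
  using (≤-refl; <⇒≤; <-trans; n<1+n; +-comm; ∸-mono; [m+n]∸[m+o]≡n∸o; <⇒≱; ≰⇒>; module ≤-Reasoning)
open import Data.Fin as Fin using (Fin; splitAt; toℕ; _↑ˡ_; fromℕ<)
open import Data.Fin.Properties as Fin
  using (↑ˡ-injective; splitAt-↑ˡ; toℕ-injective; fromℕ<-injective; injective⇒≤)
open import Data.Sum using (_⊎_; inj₁; inj₂)
open import Data.Unit using (⊤; tt)
open import Data.Empty using (⊥)
open import Data.Bool using (Bool; true; false; _∨_)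
open import Data.Bool.Properties using (∨-comm; ∨-zeroʳ)
open import Data.List using ([]; _∷_; _++_; foldr)
open import Data.List.Properties using (foldr-++)
open import Data.Vec using (Vec; []; _∷_; lookup)
open import Data.Product using (∃; _×_; _,_; proj₁; proj₂)
open import Function.Base using (_∘_)
open import Function.Definitions using (Injective)
open import Relation.Nullary using (does; yes; no)
open import Relation.Nullary.Decidable using (dec-true)
open import Relation.Nullary.Negation using (contradiction)
open import Relation.Binary.PropositionalEquality
  using (_≡_; refl; cong; sym; trans; subst₂; module ≡-Reasoning)

module BenderKnuth {A : Set} (c : A → A → Bool) where

  act : ∀ {N} → Word → Vec A N → Vec A N
  act w v = foldr (bkMove c) v w

  act-++ : ∀ {N} w w′ (v : Vec A N) → act (w ++ w′) v ≡ act w (act w′ v)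
  act-++ w w′ v = foldr-++ (bkMove c) v w w′

  bkMove-comm : ∀ {N} a b → suc b < a → (v : Vec A N) →
    bkMove c a (bkMove c b v) ≡ bkMove c b (bkMove c a v)
  bkMove-comm a zero _ v = refl
  bkMove-comm (suc (suc (suc a))) (suc zero) _ (x ∷ y ∷ xs) with c x y
  ... | true = refl
  ... | false = refl
  bkMove-comm (suc (suc (suc a))) (suc zero) _ [] = refl
  bkMove-comm (suc (suc (suc a))) (suc zero) _ (x ∷ []) = refl
  bkMove-comm (suc (suc a)) (suc (suc b)) (s≤s (s≤s b<a)) (x ∷ xs) =
    cong (x ∷_) (bkMove-comm (suc a) (suc b) (s≤s b<a) xs)
  bkMove-comm (suc (suc a)) (suc (suc b)) _ [] = refl
  bkMove-comm (suc zero) (suc zero) (s≤s ()) v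
  bkMove-comm (suc (suc zero)) (suc zero) (s≤s (s≤s ())) v

  bkMove-act-desc-comm : ∀ {N} a s → suc s < a → (v : Vec A N) →
    bkMove c a (act (desc s) v) ≡ act (desc s) (bkMove c a v)
  bkMove-act-desc-comm a zero _ v = refl
  bkMove-act-desc-comm a (suc s) s<a v =
    trans (bkMove-comm a (suc s) s<a (act (desc s) v))
      (cong (bkMove c (suc s)) (bkMove-act-desc-comm a s (<-trans (n<1+n _) s<a) v))

  bkMove-act-q-comm : ∀ {N} a r → suc r < a → (v : Vec A N) →
    bkMove c a (act (q r) v) ≡ act (q r) (bkMove c a v)
  bkMove-act-q-comm a zero _ v = refl
  bkMove-act-q-comm a (suc r) r<a v = begin
    bkMove c a (act (q r ++ desc (suc r)) v)     ≡⟨ cong (bkMove c a) (act-++ (q r) _ v) ⟩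
    bkMove c a (act (q r) (act (desc (suc r)) v)) ≡⟨ bkMove-act-q-comm a r (<-trans (n<1+n _) r<a) _ ⟩
    act (q r) (bkMove c a (act (desc (suc r)) v)) ≡⟨ cong (act (q r)) (bkMove-act-desc-comm a (suc r) r<a v) ⟩
    act (q r) (act (desc (suc r)) (bkMove c a v)) ≡⟨ act-++ (q r) _ _ ⟨
    act (q r ++ desc (suc r)) (bkMove c a v)     ∎
    where open ≡-Reasoning

  asc : ℕ → Word
  asc zero = []
  asc (suc r) = asc r ++ suc r ∷ []

  act-asc-suc : ∀ {N} r (v : Vec A N) → act (asc (suc r)) v ≡ act (asc r) (bkMove c (suc r) v)
  act-asc-suc r v = act-++ (asc r) (suc r ∷ []) v

  -- q_{r+1} = (t_1 ⋯ t_{r+1}) q_r: the other standard reduced word of the longest element.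
  act-q-suc : ∀ {N} r (v : Vec A N) → act (q (suc r)) v ≡ act (asc (suc r)) (act (q r) v)
  act-q-suc zero v = refl
  act-q-suc {N} (suc r) v = begin
    act (q (suc r) ++ desc (suc (suc r))) v                       ≡⟨ act-++ (q (suc r)) _ v ⟩
    act (q (suc r)) (bkMove c (suc (suc r)) (act (desc (suc r)) v)) ≡⟨ act-q-suc r _ ⟩
    act (asc (suc r)) (act (q r) (bkMove c (suc (suc r)) w))       ≡⟨ cong (act (asc (suc r))) (bkMove-act-q-comm (suc (suc r)) r ≤-refl w) ⟨
    act (asc (suc r)) (bkMove c (suc (suc r)) (act (q r) w))       ≡⟨ act-asc-suc (suc r) _ ⟨
    act (asc (suc (suc r))) (act (q r) w)                          ≡⟨ cong (act (asc (suc (suc r)))) (act-++ (q r) _ v) ⟨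
    act (asc (suc (suc r))) (act (q (suc r)) v)                    ∎
    where
    open ≡-Reasoning
    w : Vec A N
    w = act (desc (suc r)) v

  act-qjk : ∀ {N} j k (v : Vec A N) →
    act (qjk j k) v ≡ act (q (k ∸ 1)) (act (q (k ∸ j)) (act (q (k ∸ 1)) v))
  act-qjk j k v =
    trans (act-++ (q (k ∸ 1)) _ v) (cong (act (q (k ∸ 1))) (act-++ (q (k ∸ j)) _ v))

  act-cactusWord : ∀ {N} i j k (v : Vec A N) →
    act (cactusWord i j k) v ≡ bkMove c i (act (qjk j k) (bkMove c i (act (qjk j k) v)))
  act-cactusWord i j k v = act-++ (i ∷ qjk j k) (i ∷ qjk j k) v

  module Symmetric (c-sym : ∀ x y → c x y ≡ c y x) where

    bkMove-involutive : ∀ {N} a (v : Vec A N) → bkMove c a (bkMove c a v) ≡ v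
    bkMove-involutive zero v = refl
    bkMove-involutive (suc zero) (x ∷ y ∷ xs) with c x y in cxy
    ... | true rewrite cxy = refl
    ... | false rewrite c-sym y x | cxy = refl
    bkMove-involutive (suc zero) [] = refl
    bkMove-involutive (suc zero) (x ∷ []) = refl
    bkMove-involutive (suc (suc a)) (x ∷ xs) = cong (x ∷_) (bkMove-involutive (suc a) xs)
    bkMove-involutive (suc (suc a)) [] = refl

    act-asc-desc : ∀ {N} r (v : Vec A N) → act (asc r) (act (desc r) v) ≡ v
    act-asc-desc zero v = refl
    act-asc-desc (suc r) v =
      trans (act-asc-suc r _)
        (trans (cong (act (asc r)) (bkMove-involutive (suc r) (act (desc r) v))) (act-asc-desc r v))

    act-q-involutive : ∀ {N} r (v : Vec A N) → act (q r) (act (q r) v) ≡ v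
    act-q-involutive zero v = refl
    act-q-involutive (suc r) v = begin
      act (q (suc r)) (act (q (suc r)) v)                              ≡⟨ act-q-suc r _ ⟩
      act (asc (suc r)) (act (q r) (act (q r ++ desc (suc r)) v))      ≡⟨ cong (act (asc (suc r)) ∘ act (q r)) (act-++ (q r) _ v) ⟩
      act (asc (suc r)) (act (q r) (act (q r) (act (desc (suc r)) v))) ≡⟨ cong (act (asc (suc r))) (act-q-involutive r _) ⟩
      act (asc (suc r)) (act (desc (suc r)) v)                         ≡⟨ act-asc-desc (suc r) v ⟩
      v                                                                ∎
      where open ≡-Reasoning

    act-qjk-involutive : ∀ {N} j k (v : Vec A N) → act (qjk j k) (act (qjk j k) v) ≡ v
    act-qjk-involutive {N} j k v = begin
      act (qjk j k) (act (qjk j k) v)          ≡⟨ act-qjk j k _ ⟩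
      Q r (Q s (Q r (act (qjk j k) v)))       ≡⟨ cong (Q r ∘ Q s ∘ Q r) (act-qjk j k v) ⟩
      Q r (Q s (Q r (Q r (Q s (Q r v)))))     ≡⟨ cong (Q r ∘ Q s) (act-q-involutive r _) ⟩
      Q r (Q s (Q s (Q r v)))                 ≡⟨ cong (Q r) (act-q-involutive s _) ⟩
      Q r (Q r v)                             ≡⟨ act-q-involutive r v ⟩
      v                                       ∎
      where
      open ≡-Reasoning
      r s : ℕ
      r = k ∸ 1
      s = k ∸ j
      Q : ℕ → Vec A N → Vec A N
      Q x = act (q x)

  module UniversallyComparablePrefix (G : A → Set) (G-comparable : ∀ x → G x → ∀ y → c x y ≡ true) where

    Prefix : ∀ {N} → ℕ → Vec A N → Set
    Prefix zero v = ⊤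
    Prefix (suc m) [] = ⊤
    Prefix (suc m) (x ∷ xs) = G x × Prefix m xs

    Prefix-fromLookup : ∀ {N} m (v : Vec A N) → (∀ a → toℕ a < m → G (lookup v a)) → Prefix m v
    Prefix-fromLookup zero v f = tt
    Prefix-fromLookup (suc m) [] f = tt
    Prefix-fromLookup (suc m) (x ∷ xs) f =
      f Fin.zero (s≤s z≤n) , Prefix-fromLookup m xs (λ a a<m → f (Fin.suc a) (s≤s a<m))

    bkMove-fixes-Prefix : ∀ {N} m s {v : Vec A N} → s ≤ m → Prefix m v → bkMove c s v ≡ v
    bkMove-fixes-Prefix m zero _ _ = refl
    bkMove-fixes-Prefix (suc m) (suc zero) {x ∷ y ∷ xs} _ (Gx , _) rewrite G-comparable x Gx y = refl
    bkMove-fixes-Prefix (suc m) (suc zero) {[]} _ _ = refl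
    bkMove-fixes-Prefix (suc m) (suc zero) {x ∷ []} _ _ = refl
    bkMove-fixes-Prefix (suc m) (suc (suc s)) {x ∷ xs} (s≤s s≤m) (_ , pre) =
      cong (x ∷_) (bkMove-fixes-Prefix m (suc s) s≤m pre)
    bkMove-fixes-Prefix (suc m) (suc (suc s)) {[]} _ _ = refl

    bkMove-preserves-Prefix : ∀ {N} m s {v : Vec A N} → Prefix m v → Prefix m (bkMove c s v)
    bkMove-preserves-Prefix zero s pre = tt
    bkMove-preserves-Prefix (suc m) zero pre = pre
    bkMove-preserves-Prefix (suc m) (suc zero) {x ∷ y ∷ xs} (Gx , pre) rewrite G-comparable x Gx y = Gx , pre
    bkMove-preserves-Prefix (suc m) (suc zero) {[]} pre = pre
    bkMove-preserves-Prefix (suc m) (suc zero) {x ∷ []} pre = pre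
    bkMove-preserves-Prefix (suc m) (suc (suc s)) {x ∷ xs} (Gx , pre) = Gx , bkMove-preserves-Prefix m (suc s) pre
    bkMove-preserves-Prefix (suc m) (suc (suc s)) {[]} pre = pre

    act-preserves-Prefix : ∀ {N} m w {v : Vec A N} → Prefix m v → Prefix m (act w v)
    act-preserves-Prefix m [] pre = pre
    act-preserves-Prefix m (a ∷ w) pre = bkMove-preserves-Prefix m a (act-preserves-Prefix m w pre)

    act-desc-fixes-Prefix : ∀ {N} m s {v : Vec A N} → s ≤ m → Prefix m v → act (desc s) v ≡ v
    act-desc-fixes-Prefix m zero _ _ = refl
    act-desc-fixes-Prefix m (suc s) s<m pre =
      trans (cong (bkMove c (suc s)) (act-desc-fixes-Prefix m s (<⇒≤ s<m) pre))
        (bkMove-fixes-Prefix m (suc s) s<m pre)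

    act-q-fixes-Prefix : ∀ {N} m s {v : Vec A N} → s ≤ m → Prefix m v → act (q s) v ≡ v
    act-q-fixes-Prefix m zero _ _ = refl
    act-q-fixes-Prefix m (suc s) {v} s<m pre =
      trans (act-++ (q s) (desc (suc s)) v)
        (trans (cong (act (q s)) (act-desc-fixes-Prefix m (suc s) s<m pre))
          (act-q-fixes-Prefix m s (<⇒≤ s<m) pre))

    module _ (c-sym : ∀ x y → c x y ≡ c y x) where
      open Symmetric c-sym

      act-cactusWord-fixes-Prefix : ∀ {N} m i j k {v : Vec A N} → i ≤ m ⊎ k ∸ j ≤ m →
        Prefix m v → act (cactusWord i j k) v ≡ v
      act-cactusWord-fixes-Prefix {N} m i j k {v} (inj₁ i≤m) pre = begin
        act (cactusWord i j k) v                  ≡⟨ act-cactusWord i j k v ⟩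
        bkMove c i (Q (bkMove c i (Q v)))         ≡⟨ cong (bkMove c i ∘ Q) (bkMove-fixes-Prefix m i i≤m (act-preserves-Prefix m (qjk j k) pre)) ⟩
        bkMove c i (Q (Q v))                      ≡⟨ cong (bkMove c i) (act-qjk-involutive j k v) ⟩
        bkMove c i v                              ≡⟨ bkMove-fixes-Prefix m i i≤m pre ⟩
        v                                         ∎
        where
        open ≡-Reasoning
        Q : Vec A N → Vec A N
        Q = act (qjk j k)
      act-cactusWord-fixes-Prefix {N} m i j k {v} (inj₂ k∸j≤m) pre = begin
        act (cactusWord i j k) v                  ≡⟨ act-cactusWord i j k v ⟩
        bkMove c i (Q (bkMove c i (Q v)))         ≡⟨ cong (bkMove c i ∘ Q ∘ bkMove c i) (Q-fixes-Prefix pre) ⟩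
        bkMove c i (Q (bkMove c i v))             ≡⟨ cong (bkMove c i) (Q-fixes-Prefix (bkMove-preserves-Prefix m i pre)) ⟩
        bkMove c i (bkMove c i v)                 ≡⟨ bkMove-involutive i v ⟩
        v                                         ∎
        where
        open ≡-Reasoning
        Q : Vec A N → Vec A N
        Q = act (qjk j k)
        Q-fixes-Prefix : ∀ {w : Vec A N} → Prefix m w → Q w ≡ w
        Q-fixes-Prefix {w} pre′ = begin
          Q w                                     ≡⟨ act-qjk j k w ⟩
          act (q (k ∸ 1)) (act (q (k ∸ j)) (act (q (k ∸ 1)) w))
            ≡⟨ cong (act (q (k ∸ 1))) (act-q-fixes-Prefix m (k ∸ j) k∸j≤m (act-preserves-Prefix m (q (k ∸ 1)) pre′)) ⟩
          act (q (k ∸ 1)) (act (q (k ∸ 1)) w)    ≡⟨ act-q-involutive (k ∸ 1) w ⟩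
          w                                       ∎

comparable-sym : ∀ {N} (R : FinPoset N) x y → comparable R x y ≡ comparable R y x
comparable-sym R x y = ∨-comm (does (_≼?_ R x y)) (does (_≼?_ R y x))

module OrdinalSum {m n : ℕ} (Q : FinPoset m) (P : FinPoset n) where

  InLower : Fin (m + n) → Set
  InLower x = ∃ λ a → splitAt m x ≡ inj₁ a

  lower-≺-upper : ∀ {x y a b} → splitAt m x ≡ inj₁ a → splitAt m y ≡ inj₂ b → _≺_ (Q ⊕ P) x y
  lower-≺-upper {x} {y} x↦a y↦b = subst₂ (SumLe Q P) (sym x↦a) (sym y↦b) tt , x≢y
    where
    x≢y : x ≡ y → ⊥
    x≢y refl with trans (sym x↦a) y↦b
    ... | ()

  -- Every element of Q lies below the upper element at position a, so all m of
  -- them sit at distinct positions before a.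
  linearExtension-lower-first : (p : Vec (Fin (m + n)) (m + n)) → IsLinearExtension (Q ⊕ P) p →
    ∀ a → toℕ a < m → InLower (lookup p a)
  linearExtension-lower-first p (onto , _ , monotone) a a<m with splitAt m (lookup p a) in pa↦b
  ... | inj₁ x = x , refl
  ... | inj₂ b = contradiction (injective⇒≤ before-a-injective) (<⇒≱ a<m)
    where
    position : Fin m → Fin (m + n)
    position x = proj₁ (onto (x ↑ˡ n))

    lookup-position : ∀ x → lookup p (position x) ≡ x ↑ˡ n
    lookup-position x = proj₂ (onto (x ↑ˡ n))

    position<a : ∀ x → toℕ (position x) < toℕ a
    position<a x = monotone (position x) a
      (lower-≺-upper (trans (cong (splitAt m) (lookup-position x)) (splitAt-↑ˡ m x n)) pa↦b)

    before-a : Fin m → Fin (toℕ a)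
    before-a x = fromℕ< (position<a x)

    before-a-injective : Injective _≡_ _≡_ before-a
    before-a-injective {x} {y} eq = ↑ˡ-injective n x y (begin
      x ↑ˡ n                  ≡⟨ lookup-position x ⟨
      lookup p (position x)   ≡⟨ cong (lookup p) (toℕ-injective (fromℕ<-injective _ _ (position<a x) (position<a y) eq)) ⟩
      lookup p (position y)   ≡⟨ lookup-position y ⟩
      y ↑ˡ n                  ∎)
      where open ≡-Reasoning

chain-comparable : ∀ {m n} (P : FinPoset n) x → OrdinalSum.InLower (Chain m) P x →
  ∀ y → comparable (Chain m ⊕ P) x y ≡ true
chain-comparable {m} P x (a , x↦a) y rewrite x↦a with splitAt m y
... | inj₂ _ = refl
... | inj₁ b with Fin.≤-total a b
...   | inj₁ a≤b = cong (_∨ does (b Fin.≤? a)) (dec-true (a Fin.≤? b) a≤b)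
...   | inj₂ b≤a = trans (cong (does (a Fin.≤? b) ∨_) (dec-true (b Fin.≤? a) b≤a)) (∨-zeroʳ _)

-- Once i > m, the gap i + 1 < j pushes j to at least m + 3.
short-move-or-short-middle : ∀ m n i j k → i + 1 < j → k ≤ m + n → n ∸ 3 ≤ m → i ≤ m ⊎ k ∸ j ≤ m
short-move-or-short-middle m n i j k i+1<j k≤m+n n∸3≤m with i ℕ.≤? m
... | yes i≤m = inj₁ i≤m
... | no i≰m = inj₂ (begin
  k ∸ j             ≤⟨ ∸-mono k≤m+n m+3≤j ⟩
  (m + n) ∸ (m + 3) ≡⟨ [m+n]∸[m+o]≡n∸o m n 3 ⟩
  n ∸ 3             ≤⟨ n∸3≤m ⟩
  m                 ∎)
  where
  open ≤-Reasoning
  m+3≤j : m + 3 ≤ j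
  m+3≤j = begin
    m + 3         ≡⟨ +-comm m 3 ⟩
    3 + m         ≤⟨ s≤s (s≤s (≰⇒> i≰m)) ⟩
    suc (suc i)   ≡⟨ cong suc (+-comm 1 i) ⟩
    suc (i + 1)   ≤⟨ i+1<j ⟩
    j             ∎

proposition3p21 : ∀ (n : ℕ) (P : FinPoset n) (m : ℕ) → n ∸ 3 ≤ m →
    IsLECactus (Chain m ⊕ P)
proposition3p21 n P m n∸3≤m i j k _ i+1<j _ k≤m+n p p-linear =
  act-cactusWord-fixes-Prefix (comparable-sym (Chain m ⊕ P)) m i j k
    (short-move-or-short-middle m n i j k i+1<j k≤m+n n∸3≤m)
    (Prefix-fromLookup m p (linearExtension-lower-first p p-linear))
  where
  open OrdinalSum (Chain m) P
  open BenderKnuth (comparable (Chain m ⊕ P))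
  open UniversallyComparablePrefix InLower (chain-comparable P)
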